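{- Let $P$ be a pattern such that every row of $P$ contains at least two $1$ entries, or such that every column of $P$ contains at least two $1$ entries. Then $sat(P,n)=\Theta(n)$.
   Context: All matrices are $0$-$1$ matrices; an $m\times n$ matrix has $m$ rows and $n$ columns. The weight of a matrix is its number of $1$ entries. A pattern is a $0$-$1$ matrix that is not all-zero. A matrix $M$ contains a $k\times l$ pattern $P$ if there are rows $r_1<\dots<r_k$ and columns $c_1<\dots<c_l$ of $M$ such that $M(r_a,c_b)=1$ whenever $P(a,b)=1$; otherwise $M$ avoids $P$. A matrix $M$ is saturating for $P$ if $M$ avoids $P$ and changing any single $0$ entry of $M$ to $1$ yields a matrix containing $P$. $sat(P,m,n)$ is the minimum weight of an $m\times n$ matrix saturating for $P$, and $sat(P,n)=sat(P,n,n)$. -}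

module Defs where

open import Data.Nat using (ℕ; _+_; _≤_)
open import Data.Bool using (Bool; true; false; if_then_else_; _∧_)
open import Data.Fin using (Fin; _<_)
import Data.Fin as F
open import Data.List using (List; map)
open import Data.Nat.ListAction using (sum)
open import Data.List.Base using (allFin)
open import Data.Product using (Σ; ∃; _×_)
open import Relation.Nullary using (¬_)
open import Relation.Nullary.Decidable using (⌊_⌋)
open import Relation.Binary.PropositionalEquality using (_≡_)

Matrix : ℕ → ℕ → Set
Matrix m n = Fin m → Fin n → Bool

count : {n : ℕ} → (Fin n → Bool) → ℕ
count {n} f = sum (map (λ j → if f j then 1 else 0) (allFin n))

weight : {m n : ℕ} → Matrix m n → ℕ
weight {m} M = sum (map (λ i → count (M i)) (allFin m))

IsPattern : {k l : ℕ} → Matrix k l → Set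
IsPattern {k} {l} P = Σ (Fin k) λ a → Σ (Fin l) λ b → P a b ≡ true

StrictlyIncreasing : {k m : ℕ} → (Fin k → Fin m) → Set
StrictlyIncreasing {k} f = (a b : Fin k) → a < b → f a < f b

Contains : {m n k l : ℕ} → Matrix m n → Matrix k l → Set
Contains {m} {n} {k} {l} M P =
  Σ (Fin k → Fin m) λ r → Σ (Fin l → Fin n) λ c →
    StrictlyIncreasing r × StrictlyIncreasing c ×
    ((a : Fin k) (b : Fin l) → P a b ≡ true → M (r a) (c b) ≡ true)

Avoids : {m n k l : ℕ} → Matrix m n → Matrix k l → Set
Avoids M P = ¬ Contains M P

setOne : {m n : ℕ} → Matrix m n → Fin m → Fin n → Matrix m n
setOne M i j r c = if ⌊ r F.≟ i ⌋ ∧ ⌊ c F.≟ j ⌋ then true else M r c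

Saturating : {m n k l : ℕ} → Matrix k l → Matrix m n → Set
Saturating {m} {n} P M =
  Avoids M P ×
  ((i : Fin m) (j : Fin n) → M i j ≡ false → Contains (setOne M i j) P)

IsSat : {k l : ℕ} → Matrix k l → ℕ → ℕ → ℕ → Set
IsSat P m n s =
  (Σ (Matrix m n) λ M → Saturating P M × weight M ≡ s) ×
  ((M : Matrix m n) → Saturating P M → s ≤ weight M)

RowsAtLeastTwo : {k l : ℕ} → Matrix k l → Set
RowsAtLeastTwo {k} P = (a : Fin k) → 2 ≤ count (P a)

ColsAtLeastTwo : {k l : ℕ} → Matrix k l → Set
ColsAtLeastTwo {k} {l} P = (b : Fin l) → 2 ≤ count (λ a → P a b)

-- If every row of P has two ones, every row of a saturating matrix contains a one: setting a
-- zero of an empty row to one creates a copy of P through the new entry, but the row of P sent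
-- there has a second one, which would already lie in the empty row. Hence sat(P, n) ≥ n, and the
-- column case follows by transposition. Conversely, if the last row of a (K + 1) × l pattern P
-- has a one in column p, the n × n matrix that is all ones except for zeros in rows ≥ K and
-- columns p, ..., p + n - l avoids P, is saturating, and has at most (K + 2l) n ones. The minimum
-- defining sat exists since saturation is decidable and there are finitely many matrices.

module Submission where

open import Defs
open import Data.Nat using (ℕ; zero; suc; _+_; _*_; _≤_; _<_; z≤n; s≤s; s≤s⁻¹; z<s; s<s; _≤?_; _<?_)
open import Data.Nat.Properties
open import Data.Nat.Induction using (<-rec)
import Data.Nat.ListAction as List
open import Data.Bool using (Bool; true; false; if_then_else_; _∧_)
open import Data.Bool.Properties using (∧-comm; ¬-not) renaming (_≟_ to _≟ᵇ_)
open import Data.Fin as Fin using (Fin; zero; suc; toℕ; fromℕ; fromℕ<; _↑ˡ_; punchIn)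
import Data.Fin.Properties as Fin
open import Data.List using (map; allFin)
open import Data.List.Properties using (map-tabulate; map-cong)
open import Data.Vec as Vec using (Vec; []; _∷_; lookup)
open import Data.Vec.Properties using (lookup∘tabulate)
open import Data.Vec.Functional using (transpose)
open import Data.Product using (Σ; ∃; _×_; _,_; proj₁; proj₂)
open import Data.Sum as Sum using (_⊎_; inj₁; inj₂)
open import Function using (_∘_; _$_; id)
open import Level using (0ℓ)
open import Relation.Binary.Definitions using (tri<; tri≈; tri>)
open import Relation.Binary.PropositionalEquality
open import Relation.Nullary using (¬_; Dec; yes; no; contradiction)
open import Relation.Nullary.Decidable
  using (⌊_⌋; map′; ¬?; _×-dec_; _→-dec_; isYes≗does; dec-true; decidable-stable)
open import Relation.Unary using (Pred; Decidable)
open import Algebra.Properties.Semiring.Sum +-*-semiring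
  using (sum; sum-syntax; sum-cong-≗; sum-remove; sum-replicate-zero; ∑-comm; ∑-distrib-+; *-distribˡ-sum)

variable
  k l m n : ℕ

⌊⌋≡true⇒ : {A : Set} (a? : Dec A) → ⌊ a? ⌋ ≡ true → A
⌊⌋≡true⇒ (yes a) _ = a

⌊⌋≡false⇒¬ : {A : Set} (a? : Dec A) → ⌊ a? ⌋ ≡ false → ¬ A
⌊⌋≡false⇒¬ (no ¬a) _ = ¬a

indicator : Bool → ℕ
indicator b = if b then 1 else 0

indicator≤1 : ∀ b → indicator b ≤ 1
indicator≤1 true = ≤-refl
indicator≤1 false = z≤n

sum-allFin : (g : Fin n → ℕ) → List.sum (map g (allFin n)) ≡ ∑[ i < n ] g i
sum-allFin {n} g = trans (cong List.sum (map-tabulate id g)) (sum-tabulate g)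
  where
  sum-tabulate : ∀ {n} (g : Fin n → ℕ) → List.sum (Data.List.tabulate g) ≡ ∑[ i < n ] g i
  sum-tabulate {zero} g = refl
  sum-tabulate {suc n} g = cong (g zero +_) (sum-tabulate (g ∘ suc))

count≡∑ : (f : Fin n → Bool) → count f ≡ ∑[ j < n ] indicator (f j)
count≡∑ f = sum-allFin (indicator ∘ f)

weight≡∑ : (M : Matrix m n) → weight M ≡ ∑[ i < m ] count (M i)
weight≡∑ M = sum-allFin (count ∘ M)

∑-mono-≤ : {f g : Fin n → ℕ} → (∀ i → f i ≤ g i) → ∑[ i < n ] f i ≤ ∑[ i < n ] g i
∑-mono-≤ {zero} _ = z≤n
∑-mono-≤ {suc n} f≤g = +-mono-≤ (f≤g zero) (∑-mono-≤ (f≤g ∘ suc))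

∑-const : ∀ n c → ∑[ i < n ] c ≡ n * c
∑-const zero c = refl
∑-const (suc n) c = cong (c +_) (∑-const n c)

count≤n : (f : Fin n → Bool) → count f ≤ n
count≤n {n} f = begin
  count f                      ≡⟨ count≡∑ f ⟩
  ∑[ j < n ] indicator (f j)   ≤⟨ ∑-mono-≤ (indicator≤1 ∘ f) ⟩
  ∑[ j < n ] 1                 ≡⟨ ∑-const n 1 ⟩
  n * 1                        ≡⟨ *-identityʳ n ⟩
  n                            ∎
  where open ≤-Reasoning

count-remove : (f : Fin (suc n) → Bool) (b : Fin (suc n)) →
               count f ≡ indicator (f b) + count (f ∘ punchIn b)
count-remove f b = begin
  count f                                           ≡⟨ count≡∑ f ⟩
  sum (indicator ∘ f)                               ≡⟨ sum-remove {i = b} (indicator ∘ f) ⟩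
  indicator (f b) + sum (indicator ∘ f ∘ punchIn b) ≡⟨ cong (indicator (f b) +_) (count≡∑ (f ∘ punchIn b)) ⟨
  indicator (f b) + count (f ∘ punchIn b)           ∎
  where open ≡-Reasoning

count-≥1 : (f : Fin n → Bool) (j : Fin n) → f j ≡ true → 1 ≤ count f
count-≥1 {suc n} f j fj rewrite count-remove f j | fj = s≤s z≤n

count-zeros : (f : Fin n → Bool) → (∀ j → f j ≡ false) → count f ≡ 0
count-zeros {n} f zeros =
  trans (count≡∑ f) (trans (sum-cong-≗ (cong indicator ∘ zeros)) (sum-replicate-zero n))

one-of-positive-count : (f : Fin n → Bool) → 0 < count f → ∃ λ j → f j ≡ true
one-of-positive-count f positive with Fin.any? (λ j → f j ≟ᵇ true)
... | yes one = one
... | no none = contradiction (count-zeros f (λ j → ¬-not (λ fj → none (j , fj)))) (>⇒≢ positive)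

another-one : (f : Fin n → Bool) → 2 ≤ count f → (b : Fin n) → ∃ λ b′ → b′ ≢ b × f b′ ≡ true
another-one {suc n} f two b with one-of-positive-count (f ∘ punchIn b) rest-positive
  where
  rest-positive : 1 ≤ count (f ∘ punchIn b)
  rest-positive = s≤s⁻¹ (begin
    2                                        ≤⟨ two ⟩
    count f                                  ≡⟨ count-remove f b ⟩
    indicator (f b) + count (f ∘ punchIn b)  ≤⟨ +-monoˡ-≤ _ (indicator≤1 (f b)) ⟩
    1 + count (f ∘ punchIn b)                ∎)
    where open ≤-Reasoning
... | j , one = punchIn b j , Fin.punchInᵢ≢i b j , one

count-≤-ends : ∀ a b (f : Fin n → Bool) → (∀ j → f j ≡ true → toℕ j < a ⊎ n ≤ toℕ j + b) →
               count f ≤ a + b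
count-≤-ends a b f ends = subst (_≤ a + b) (sym (count≡∑ f)) (go a f ends)
  where
  go : ∀ {n} a (f : Fin n → Bool) → (∀ j → f j ≡ true → toℕ j < a ⊎ n ≤ toℕ j + b) →
       ∑[ j < n ] indicator (f j) ≤ a + b
  go {zero} a f ends = z≤n
  go {suc n} a f ends with f zero in f0
  ... | false = go a (f ∘ suc) (λ j → Sum.map (<-trans (n<1+n _)) s≤s⁻¹ ∘ ends (suc j))
  ... | true with ends zero f0
  ...   | inj₁ (s≤s z≤n) = s≤s (go _ (f ∘ suc) (λ j → Sum.map s≤s⁻¹ s≤s⁻¹ ∘ ends (suc j)))
  ...   | inj₂ n<b =
    ≤-trans (s≤s (subst (_≤ n) (count≡∑ (f ∘ suc)) (count≤n (f ∘ suc)))) (≤-trans n<b (m≤n+m b a))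

weight-≤-rows : (M : Matrix m n) (K c : ℕ) → (∀ i → toℕ i < K ⊎ count (M i) ≤ c) →
                weight M ≤ n * K + m * c
weight-≤-rows {m} {n} M K c rows = begin
  weight M                                             ≡⟨ weight≡∑ M ⟩
  ∑[ i < m ] count (M i)                               ≤⟨ ∑-mono-≤ row-bound ⟩
  ∑[ i < m ] (n * indicator (top i) + c)               ≡⟨ ∑-distrib-+ (λ i → n * indicator (top i)) (λ _ → c) ⟩
  ∑[ i < m ] (n * indicator (top i)) + ∑[ i < m ] c    ≡⟨ cong₂ _+_ (*-distribˡ-sum n (indicator ∘ top))
                                                                   (sym (∑-const m c)) ⟨
  n * ∑[ i < m ] indicator (top i) + m * c             ≡⟨ cong (λ t → n * t + m * c) (count≡∑ top) ⟨
  n * count top + m * c                                ≤⟨ +-monoˡ-≤ (m * c) (*-monoʳ-≤ n top-count) ⟩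
  n * K + m * c                                        ∎
  where
  open ≤-Reasoning
  top : Fin m → Bool
  top i = ⌊ toℕ i <? K ⌋
  top-count : count top ≤ K
  top-count = subst (count top ≤_) (+-identityʳ K)
    (count-≤-ends K 0 top (λ i top-i → inj₁ (⌊⌋≡true⇒ (toℕ i <? K) top-i)))
  row-bound : ∀ i → count (M i) ≤ n * indicator (top i) + c
  row-bound i with toℕ i <? K | rows i
  ... | yes _   | _         = ≤-trans (count≤n (M i)) (≤-trans (≤-reflexive (sym (*-identityʳ n))) (m≤m+n _ c))
  ... | no _    | inj₂ ≤c   = ≤-trans ≤c (m≤n+m c _)
  ... | no i≮K  | inj₁ i<K  = contradiction i<K i≮K

setOne-hit : (M : Matrix m n) (i : Fin m) (j : Fin n) → setOne M i j i j ≡ true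
setOne-hit M i j with i Fin.≟ i | j Fin.≟ j
... | yes _   | yes _   = refl
... | no i≢i  | _       = contradiction refl i≢i
... | yes _   | no j≢j  = contradiction refl j≢j

setOne-keep : (M : Matrix m n) (i : Fin m) (j : Fin n) (x : Fin m) (y : Fin n) →
              M x y ≡ true → setOne M i j x y ≡ true
setOne-keep M i j x y one with ⌊ x Fin.≟ i ⌋ ∧ ⌊ y Fin.≟ j ⌋
... | true = refl
... | false = one

setOne-elim : (M : Matrix m n) (i : Fin m) (j : Fin n) (x : Fin m) (y : Fin n) →
              setOne M i j x y ≡ true → (x ≡ i × y ≡ j) ⊎ M x y ≡ true
setOne-elim M i j x y one with x Fin.≟ i | y Fin.≟ j
... | yes x≡i | yes y≡j = inj₁ (x≡i , y≡j)
... | yes _   | no _    = inj₂ one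
... | no _    | _       = inj₂ one

setOne-cong : {M M′ : Matrix m n} → (∀ x y → M x y ≡ M′ x y) →
              ∀ i j x y → setOne M i j x y ≡ setOne M′ i j x y
setOne-cong M≐M′ i j x y = cong (if_then_else_ _ true) (M≐M′ x y)

setOne-transpose : (M : Matrix m n) (i : Fin m) (j : Fin n) (x : Fin m) (y : Fin n) →
                   setOne (transpose M) j i y x ≡ setOne M i j x y
setOne-transpose M i j x y =
  cong (λ hit → if hit then true else M x y) (∧-comm ⌊ y Fin.≟ j ⌋ ⌊ x Fin.≟ i ⌋)

Contains-mono : {M M′ : Matrix m n} (P : Matrix k l) → (∀ x y → M x y ≡ true → M′ x y ≡ true) →
                Contains M P → Contains M′ P
Contains-mono P M⊆M′ (r , c , r↑ , c↑ , embeds) = r , c , r↑ , c↑ , λ a b pab → M⊆M′ _ _ (embeds a b pab)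

Contains-transpose : {M : Matrix m n} {P : Matrix k l} → Contains M P → Contains (transpose M) (transpose P)
Contains-transpose (r , c , r↑ , c↑ , embeds) = c , r , c↑ , r↑ , λ b a → embeds a b

Saturating-cong : {M M′ : Matrix m n} (P : Matrix k l) → (∀ x y → M x y ≡ M′ x y) →
                  Saturating P M → Saturating P M′
Saturating-cong P M≐M′ (avoids , saturated) =
  avoids ∘ Contains-mono P (λ x y → trans (M≐M′ x y)) ,
  λ i j zero-ij → Contains-mono P (λ x y → trans (sym (setOne-cong M≐M′ i j x y)))
                                 (saturated i j (trans (M≐M′ i j) zero-ij))

Saturating-transpose : {M : Matrix m n} (P : Matrix k l) → Saturating P M → Saturating (transpose P) (transpose M)
Saturating-transpose {M = M} P (avoids , saturated) =
  avoids ∘ Contains-transpose {M = transpose M} {P = transpose P} ,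
  λ j i zero-ij → Contains-mono (transpose P) (λ y x → trans (setOne-transpose M i j x y))
                                (Contains-transpose {M = setOne M i j} (saturated i j zero-ij))

weight-cong : {M M′ : Matrix m n} → (∀ x y → M x y ≡ M′ x y) → weight M ≡ weight M′
weight-cong M≐M′ =
  cong List.sum (map-cong (λ i → cong List.sum (map-cong (cong indicator ∘ M≐M′ i) (allFin _))) (allFin _))

weight-transpose : (M : Matrix m n) → weight (transpose M) ≡ weight M
weight-transpose {m} {n} M = begin
  weight (transpose M)                       ≡⟨ weight≡∑ (transpose M) ⟩
  ∑[ j < n ] count (transpose M j)           ≡⟨ sum-cong-≗ (count≡∑ ∘ transpose M) ⟩
  ∑[ j < n ] ∑[ i < m ] indicator (M i j)    ≡⟨ ∑-comm (λ i j → indicator (M i j)) ⟨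
  ∑[ i < m ] ∑[ j < n ] indicator (M i j)    ≡⟨ sum-cong-≗ (count≡∑ ∘ M) ⟨
  ∑[ i < m ] count (M i)                     ≡⟨ weight≡∑ M ⟨
  weight M                                   ∎
  where open ≡-Reasoning

IsSat-transpose : (P : Matrix k l) {s : ℕ} → IsSat P m n s → IsSat (transpose P) n m s
IsSat-transpose P {s} ((M , saturating , weight≡s) , minimal) =
  (transpose M , Saturating-transpose P saturating , trans (weight-transpose M) weight≡s) ,
  λ M′ saturating′ → subst (s ≤_) (weight-transpose M′)
                       (minimal (transpose M′) (Saturating-transpose (transpose P) saturating′))

increasing-injective : {f : Fin k → Fin m} → StrictlyIncreasing f → ∀ {a b} → f a ≡ f b → a ≡ b
increasing-injective f↑ {a} {b} fa≡fb with Fin.<-cmp a b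
... | tri< a<b _ _ = contradiction (f↑ a b a<b) (<-irrefl (cong toℕ fa≡fb))
... | tri≈ _ a≡b _ = a≡b
... | tri> _ _ b<a = contradiction (f↑ b a b<a) (<-irrefl (cong toℕ (sym fa≡fb)))

increasing-tail : {f : Fin (suc k) → Fin m} → StrictlyIncreasing f → StrictlyIncreasing (f ∘ suc)
increasing-tail f↑ a b = f↑ (suc a) (suc b) ∘ s<s

increasing-gap : {f : Fin k → Fin m} → StrictlyIncreasing f → ∀ a b → toℕ a ≤ toℕ b →
                 toℕ (f a) + toℕ b ≤ toℕ (f b) + toℕ a
increasing-gap f↑ zero zero _ = ≤-refl
increasing-gap {suc (suc k)} {f = f} f↑ zero (suc b) _ = begin
  toℕ (f zero) + suc (toℕ b)   ≡⟨ +-suc _ _ ⟩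
  suc (toℕ (f zero) + toℕ b)   ≤⟨ +-monoˡ-≤ (toℕ b) (f↑ zero (suc zero) z<s) ⟩
  toℕ (f (suc zero)) + toℕ b   ≤⟨ increasing-gap (increasing-tail f↑) zero b z≤n ⟩
  toℕ (f (suc b)) + 0          ∎
  where open ≤-Reasoning
increasing-gap {f = f} f↑ (suc a) (suc b) a≤b = begin
  toℕ (f (suc a)) + suc (toℕ b)   ≡⟨ +-suc _ _ ⟩
  suc (toℕ (f (suc a)) + toℕ b)   ≤⟨ s≤s (increasing-gap (increasing-tail f↑) a b (s≤s⁻¹ a≤b)) ⟩
  suc (toℕ (f (suc b)) + toℕ a)   ≡⟨ +-suc _ _ ⟨
  toℕ (f (suc b)) + suc (toℕ a)   ∎
  where open ≤-Reasoning

increasing-inflationary : {f : Fin k → Fin m} → StrictlyIncreasing f → ∀ x → toℕ x ≤ toℕ (f x)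
increasing-inflationary {suc k} {f = f} f↑ x = begin
  toℕ x                      ≤⟨ m≤n+m (toℕ x) _ ⟩
  toℕ (f zero) + toℕ x       ≤⟨ increasing-gap f↑ zero x z≤n ⟩
  toℕ (f x) + 0              ≡⟨ +-identityʳ _ ⟩
  toℕ (f x)                  ∎
  where open ≤-Reasoning

increasing-room : {f : Fin k → Fin m} → StrictlyIncreasing f → ∀ x → toℕ (f x) + k ≤ m + toℕ x
increasing-room {suc k} {m} {f} f↑ x = begin
  toℕ (f x) + suc k                ≡⟨ +-suc _ k ⟩
  suc (toℕ (f x) + k)              ≤⟨ s≤s gap-to-last ⟩
  suc (toℕ (f (fromℕ k)) + toℕ x)  ≤⟨ +-monoˡ-≤ (toℕ x) (Fin.toℕ<n (f (fromℕ k))) ⟩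
  m + toℕ x                        ∎
  where
  open ≤-Reasoning
  gap-to-last : toℕ (f x) + k ≤ toℕ (f (fromℕ k)) + toℕ x
  gap-to-last = subst (λ t → toℕ (f x) + t ≤ toℕ (f (fromℕ k)) + toℕ x) (Fin.toℕ-fromℕ k) $
    increasing-gap f↑ x (fromℕ k) (subst (toℕ x ≤_) (sym (Fin.toℕ-fromℕ k)) (Fin.toℕ≤pred[n] x))

finMap : (γ : ℕ → ℕ) → (∀ {b} → b < l → γ b < n) → Fin l → Fin n
finMap γ γ< b = fromℕ< (γ< (Fin.toℕ<n b))

toℕ-finMap : (γ : ℕ → ℕ) (γ< : ∀ {b} → b < l → γ b < n) (b : Fin l) → toℕ (finMap γ γ< b) ≡ γ (toℕ b)
toℕ-finMap γ γ< b = Fin.toℕ-fromℕ< _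

finMap-increasing : (γ : ℕ → ℕ) (γ< : ∀ {b} → b < l → γ b < n) →
                    (∀ {a b} → a < b → b < l → γ a < γ b) → StrictlyIncreasing (finMap γ γ<)
finMap-increasing γ γ< γ↑ a b a<b =
  subst₂ _<_ (sym (toℕ-finMap γ γ< a)) (sym (toℕ-finMap γ γ< b)) (γ↑ a<b (Fin.toℕ<n b))

Searchable : Set → Set₁
Searchable A = {Q : Pred A 0ℓ} → Decidable Q → Dec (∃ Q)

Bool-searchable : Searchable Bool
Bool-searchable Q? with Q? true | Q? false
... | yes q    | _        = yes (true , q)
... | no _     | yes q    = yes (false , q)
... | no ¬qt   | no ¬qf   = no λ { (true , q) → ¬qt q ; (false , q) → ¬qf q }

Vec-searchable : {A : Set} → Searchable A → Searchable (Vec A n)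
Vec-searchable {zero} search Q? = map′ ([] ,_) (λ { ([] , q) → q }) (Q? [])
Vec-searchable {suc n} search Q? =
  map′ (λ (x , xs , q) → x ∷ xs , q) (λ { (x ∷ xs , q) → x , xs , q })
       (search λ x → Vec-searchable search (Q? ∘ (x ∷_)))

Embeds : Matrix m n → Matrix k l → (Fin k → Fin m) → (Fin l → Fin n) → Set
Embeds M P r c = StrictlyIncreasing r × StrictlyIncreasing c × (∀ a b → P a b ≡ true → M (r a) (c b) ≡ true)

increasing? : (f : Fin k → Fin m) → Dec (StrictlyIncreasing f)
increasing? f = Fin.all? λ a → Fin.all? λ b → a Fin.<? b →-dec f a Fin.<? f b

embeds? : (M : Matrix m n) (P : Matrix k l) (r : Fin k → Fin m) (c : Fin l → Fin n) → Dec (Embeds M P r c)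
embeds? M P r c = increasing? r ×-dec increasing? c ×-dec
  Fin.all? λ a → Fin.all? λ b → P a b ≟ᵇ true →-dec M (r a) (c b) ≟ᵇ true

Embeds-≗ : (M : Matrix m n) (P : Matrix k l) {r r′ : Fin k → Fin m} {c c′ : Fin l → Fin n} →
           r ≗ r′ → c ≗ c′ → Embeds M P r c → Embeds M P r′ c′
Embeds-≗ M P r≗r′ c≗c′ (r↑ , c↑ , embeds) =
  (λ a b a<b → subst₂ Fin._<_ (r≗r′ a) (r≗r′ b) (r↑ a b a<b)) ,
  (λ a b a<b → subst₂ Fin._<_ (c≗c′ a) (c≗c′ b) (c↑ a b a<b)) ,
  λ a b pab → subst₂ (λ x y → M x y ≡ true) (r≗r′ a) (c≗c′ b) (embeds a b pab)

contains? : (M : Matrix m n) (P : Matrix k l) → Dec (Contains M P)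
contains? M P =
  map′ (λ (rs , cs , embeds) → lookup rs , lookup cs , embeds)
       (λ (r , c , embeds) → Vec.tabulate r , Vec.tabulate c ,
                             Embeds-≗ M P (sym ∘ lookup∘tabulate r) (sym ∘ lookup∘tabulate c) embeds)
       (Vec-searchable Fin.any? λ rs → Vec-searchable Fin.any? λ cs → embeds? M P (lookup rs) (lookup cs))

saturating? : (P : Matrix k l) (M : Matrix m n) → Dec (Saturating P M)
saturating? P M = ¬? (contains? M P) ×-dec
  Fin.all? λ i → Fin.all? λ j → M i j ≟ᵇ false →-dec contains? (setOne M i j) P

SaturatingOfWeight : Matrix k l → (m n w : ℕ) → Set
SaturatingOfWeight P m n w = ∃ λ (M : Matrix m n) → Saturating P M × weight M ≡ w

saturatingOfWeight? : (P : Matrix k l) (m n : ℕ) → Decidable (SaturatingOfWeight P m n)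
saturatingOfWeight? P m n w =
  map′ (λ (rows , q) → fromRows rows , q)
       (λ (M , saturating , weight≡w) → toRows M ,
          Saturating-cong P (λ i j → sym (fromRows-toRows M i j)) saturating ,
          trans (weight-cong (λ i j → fromRows-toRows M i j)) weight≡w)
       (Vec-searchable (Vec-searchable Bool-searchable) λ rows →
          saturating? P (fromRows rows) ×-dec weight (fromRows rows) ≟ w)
  where
  fromRows : Vec (Vec Bool n) m → Matrix m n
  fromRows rows i j = lookup (lookup rows i) j
  toRows : Matrix m n → Vec (Vec Bool n) m
  toRows M = Vec.tabulate (Vec.tabulate ∘ M)
  fromRows-toRows : ∀ M i j → fromRows (toRows M) i j ≡ M i j
  fromRows-toRows M i j =
    trans (cong (λ row → lookup row j) (lookup∘tabulate (Vec.tabulate ∘ M) i)) (lookup∘tabulate (M i) j)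

least : {D : Pred ℕ 0ℓ} → Decidable D → ∀ {w} → D w → ∃ λ s → D s × (∀ {t} → D t → s ≤ t)
least {D} D? {w} = <-rec (λ w → D w → ∃ λ s → D s × (∀ {t} → D t → s ≤ t)) step w
  where
  step : ∀ w → (∀ {t} → t < w → D t → ∃ λ s → D s × (∀ {t} → D t → s ≤ t)) →
         D w → ∃ λ s → D s × (∀ {t} → D t → s ≤ t)
  step w smaller Dw with anyUpTo? D? w
  ... | yes (t , t<w , Dt) = smaller t<w Dt
  ... | no nothing-below  = w , Dw , λ {t} Dt → ≮⇒≥ λ t<w → nothing-below (t , t<w , Dt)

sat-exists : (P : Matrix k l) {M : Matrix m n} → Saturating P M → ∃ λ s → IsSat P m n s
sat-exists {m = m} {n} P {M} saturating
  with least (saturatingOfWeight? P m n) (M , saturating , refl)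
... | s , witness , minimal = s , witness , λ M′ saturating′ → minimal (M′ , saturating′ , refl)

saturating-row-nonempty : {P : Matrix k l} {M : Matrix m n} → RowsAtLeastTwo P → Saturating P M →
                          Fin n → (i : Fin m) → ∃ λ j → M i j ≡ true
saturating-row-nonempty {P = P} {M} rows (avoids , saturated) j₀ i
  with Fin.any? (λ j → M i j ≟ᵇ true)
... | yes one = one
... | no empty with saturated i j₀ (¬-not (λ one → empty (j₀ , one)))
...   | r , c , r↑ , c↑ , embeds′ = contradiction (r , c , r↑ , c↑ , embeds) avoids
  where
  embeds : ∀ a b → P a b ≡ true → M (r a) (c b) ≡ true
  embeds a b pab with setOne-elim M i j₀ _ _ (embeds′ a b pab)
  ... | inj₂ one = one
  ... | inj₁ (ra≡i , cb≡j₀) with another-one (P a) (rows a) b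
  ...   | b′ , b′≢b , pab′ with setOne-elim M i j₀ _ _ (embeds′ a b′ pab′)
  ...     | inj₁ (_ , cb′≡j₀) = contradiction (increasing-injective c↑ (trans cb′≡j₀ (sym cb≡j₀))) b′≢b
  ...     | inj₂ one = contradiction (c b′ , subst (λ x → M x (c b′) ≡ true) ra≡i one) empty

rows-weight-lower : {P : Matrix k l} {M : Matrix m n} → RowsAtLeastTwo P → Saturating P M →
                    Fin n → m ≤ weight M
rows-weight-lower {m = m} {M = M} rows saturating j₀ = begin
  m                         ≡⟨ *-identityʳ m ⟨
  m * 1                     ≡⟨ ∑-const m 1 ⟨
  ∑[ i < m ] 1              ≤⟨ ∑-mono-≤ row-count ⟩
  ∑[ i < m ] count (M i)    ≡⟨ weight≡∑ M ⟨
  weight M                  ∎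
  where
  open ≤-Reasoning
  row-count : ∀ i → 1 ≤ count (M i)
  row-count i with saturating-row-nonempty rows saturating j₀ i
  ... | j , one = count-≥1 (M i) j one

rows-sat-lower : {P : Matrix k l} {s : ℕ} → RowsAtLeastTwo P → IsSat P m n s → Fin n → m ≤ s
rows-sat-lower {m = m} rows ((M , saturating , weight≡s) , _) j₀ =
  subst (m ≤_) weight≡s (rows-weight-lower rows saturating j₀)

module Notched (K d : ℕ) {l : ℕ} (p : Fin l) where

  InNotch : ℕ → ℕ → Set
  InNotch i j = K ≤ i × toℕ p ≤ j × j ≤ d + toℕ p

  inNotch? : ∀ i j → Dec (InNotch i j)
  inNotch? i j = K ≤? i ×-dec toℕ p ≤? j ×-dec j ≤? d + toℕ p

  M : Matrix (l + d) (l + d)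
  M i j = ⌊ ¬? (inNotch? (toℕ i) (toℕ j)) ⌋

  M-outside : ∀ {i j} → ¬ InNotch (toℕ i) (toℕ j) → M i j ≡ true
  M-outside {i} {j} = trans (isYes≗does notch?) ∘ dec-true notch?
    where notch? = ¬? (inNotch? (toℕ i) (toℕ j))

  M-one⇒outside : ∀ {i j} → M i j ≡ true → ¬ InNotch (toℕ i) (toℕ j)
  M-one⇒outside {i} {j} = ⌊⌋≡true⇒ (¬? (inNotch? (toℕ i) (toℕ j)))

  M-zero⇒inside : ∀ {i j} → M i j ≡ false → InNotch (toℕ i) (toℕ j)
  M-zero⇒inside {i} {j} =
    decidable-stable (inNotch? (toℕ i) (toℕ j)) ∘ ⌊⌋≡false⇒¬ (¬? (inNotch? (toℕ i) (toℕ j)))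

  -- A copy of P maps its last row to a row ≥ K and its column p to one of p, ..., p + d,
  -- so the one P (K, p) would have to sit in the notch.
  avoids : (P : Matrix (suc K) l) → P (fromℕ K) p ≡ true → Avoids M P
  avoids P last-p (r , c , r↑ , c↑ , embeds) =
    M-one⇒outside (embeds (fromℕ K) p last-p) (K≤r , increasing-inflationary c↑ p , c≤d+p)
    where
    K≤r : K ≤ toℕ (r (fromℕ K))
    K≤r = subst (_≤ toℕ (r (fromℕ K))) (Fin.toℕ-fromℕ K) (increasing-inflationary r↑ (fromℕ K))
    c≤d+p : toℕ (c p) ≤ d + toℕ p
    c≤d+p = +-cancelʳ-≤ l _ _ (begin
      toℕ (c p) + l        ≤⟨ increasing-room c↑ p ⟩
      l + d + toℕ p        ≡⟨ +-assoc l d (toℕ p) ⟩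
      l + (d + toℕ p)      ≡⟨ +-comm l _ ⟩
      d + toℕ p + l        ∎)
      where open ≤-Reasoning

  module Refill (P : Matrix (suc K) l) (i j : Fin (l + d)) (notch : InNotch (toℕ i) (toℕ j)) where

    K≤i : K ≤ toℕ i
    K≤i = proj₁ notch

    p≤j : toℕ p ≤ toℕ j
    p≤j = proj₁ (proj₂ notch)

    j≤d+p : toℕ j ≤ d + toℕ p
    j≤d+p = proj₂ (proj₂ notch)

    rowOf : ℕ → ℕ
    rowOf a with a <? K
    ... | yes _ = a
    ... | no _  = toℕ i

    columnOf : ℕ → ℕ
    columnOf b with <-cmp b (toℕ p)
    ... | tri< _ _ _ = b
    ... | tri≈ _ _ _ = toℕ j
    ... | tri> _ _ _ = d + b

    rowOf< : ∀ {a} → a < suc K → rowOf a < l + d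
    rowOf< {a} _ with a <? K
    ... | yes a<K = <-trans (<-≤-trans a<K K≤i) (Fin.toℕ<n i)
    ... | no _    = Fin.toℕ<n i

    rowOf↑ : ∀ {a b} → a < b → b < suc K → rowOf a < rowOf b
    rowOf↑ {a} {b} a<b b≤K with a <? K | b <? K
    ... | yes _   | yes _ = a<b
    ... | yes a<K | no _  = <-≤-trans a<K K≤i
    ... | no a≮K  | _     = contradiction (<-≤-trans a<b (s≤s⁻¹ b≤K)) a≮K

    columnOf< : ∀ {b} → b < l → columnOf b < l + d
    columnOf< {b} b<l with <-cmp b (toℕ p)
    ... | tri< _ _ _ = <-≤-trans b<l (m≤m+n l d)
    ... | tri≈ _ _ _ = Fin.toℕ<n j
    ... | tri> _ _ _ = subst (d + b <_) (+-comm d l) (+-monoʳ-< d b<l)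

    columnOf↑ : ∀ {a b} → a < b → columnOf a < columnOf b
    columnOf↑ {a} {b} a<b with <-cmp a (toℕ p) | <-cmp b (toℕ p)
    ... | tri< _ _ _    | tri< _ _ _    = a<b
    ... | tri< a<p _ _  | tri≈ _ _ _    = <-≤-trans a<p p≤j
    ... | tri< _ _ _    | tri> _ _ _    = <-≤-trans a<b (m≤n+m b d)
    ... | tri≈ _ refl _ | tri< b<p _ _  = contradiction b<p (<-asym a<b)
    ... | tri≈ _ refl _ | tri≈ _ refl _ = contradiction a<b (<-irrefl refl)
    ... | tri≈ _ refl _ | tri> _ _ _    = ≤-<-trans j≤d+p (+-monoʳ-< d a<b)
    ... | tri> _ _ p<a  | tri< b<p _ _  = contradiction (<-trans p<a a<b) (<-asym b<p)
    ... | tri> _ _ p<a  | tri≈ _ refl _ = contradiction (<-trans p<a a<b) (<-irrefl refl)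
    ... | tri> _ _ _    | tri> _ _ _    = +-monoʳ-< d a<b

    Placed : ℕ → ℕ → Set
    Placed x y = (x ≡ toℕ i × y ≡ toℕ j) ⊎ ¬ InNotch x y

    placed : ∀ a b → Placed (rowOf a) (columnOf b)
    placed a b with a <? K
    ... | yes a<K = inj₂ λ (K≤a , _) → <⇒≱ a<K K≤a
    ... | no _ with <-cmp b (toℕ p)
    ...   | tri< b<p _ _ = inj₂ λ (_ , p≤b , _) → <⇒≱ b<p p≤b
    ...   | tri≈ _ _ _   = inj₁ (refl , refl)
    ...   | tri> _ _ p<b = inj₂ λ (_ , _ , d+b≤d+p) → <⇒≱ (+-monoʳ-< d p<b) d+b≤d+p

    fill : ∀ x y → Placed (toℕ x) (toℕ y) → setOne M i j x y ≡ true
    fill x y (inj₁ (x≡i , y≡j)) rewrite Fin.toℕ-injective x≡i | Fin.toℕ-injective y≡j = setOne-hit M i j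
    fill x y (inj₂ outside) = setOne-keep M i j x y (M-outside outside)

    rows : Fin (suc K) → Fin (l + d)
    rows = finMap rowOf rowOf<

    columns : Fin l → Fin (l + d)
    columns = finMap columnOf columnOf<

    copy : Contains (setOne M i j) P
    copy = rows , columns ,
      finMap-increasing rowOf rowOf< rowOf↑ ,
      finMap-increasing columnOf columnOf< (λ a<b _ → columnOf↑ a<b) ,
      λ a b _ → fill (rows a) (columns b)
                  (subst₂ Placed (sym (toℕ-finMap rowOf rowOf< a)) (sym (toℕ-finMap columnOf columnOf< b))
                          (placed (toℕ a) (toℕ b)))

  saturating : (P : Matrix (suc K) l) → P (fromℕ K) p ≡ true → Saturating P M
  saturating P last-p = avoids P last-p , λ i j zero → Refill.copy P i j (M-zero⇒inside zero)

  weight-M : weight M ≤ (K + (l + l)) * (l + d)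
  weight-M = ≤-trans (weight-≤-rows M K (l + l) row-bound)
                     (≤-reflexive (trans (sym (*-distribˡ-+ (l + d) K (l + l))) (*-comm (l + d) _)))
    where
    row-bound : ∀ i → toℕ i < K ⊎ count (M i) ≤ l + l
    row-bound i with toℕ i <? K
    ... | yes i<K = inj₁ i<K
    ... | no i≮K  = inj₂ (count-≤-ends l l (M i) ends)
      where
      ends : ∀ j → M i j ≡ true → toℕ j < l ⊎ l + d ≤ toℕ j + l
      ends j one with toℕ j <? toℕ p
      ... | yes j<p = inj₁ (<-trans j<p (Fin.toℕ<n p))
      ... | no j≮p  = inj₂ (subst (_≤ toℕ j + l) (+-comm d l) (+-monoˡ-≤ l d≤j))
        where
        d+p<j : d + toℕ p < toℕ j
        d+p<j = ≰⇒> λ j≤d+p → M-one⇒outside one (≮⇒≥ i≮K , ≮⇒≥ j≮p , j≤d+p)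
        d≤j : d ≤ toℕ j
        d≤j = ≤-trans (m≤m+n d (toℕ p)) (<⇒≤ d+p<j)

LinearSat : Matrix k l → Set
LinearSat P = Σ ℕ λ c → Σ ℕ λ C → Σ ℕ λ N → (n : ℕ) → N ≤ n →
  Σ ℕ λ s → IsSat P n n s × n ≤ c * s × s ≤ C * n

LinearSat-transpose : (P : Matrix k l) → LinearSat (transpose P) → LinearSat P
LinearSat-transpose P (c , C , N , bounds) = c , C , N , λ n N≤n →
  let s , isSat , lower , upper = bounds n N≤n in s , IsSat-transpose (transpose P) isSat , lower , upper

linearSat-rows : (P : Matrix k l) → IsPattern P → RowsAtLeastTwo P → LinearSat P
linearSat-rows {zero} P (() , _) rows
linearSat-rows {suc K} {l} P _ rows = 1 , K + (l + l) , l , bounds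
  where
  last-row-one : ∃ λ p → P (fromℕ K) p ≡ true
  last-row-one = one-of-positive-count (P (fromℕ K)) (≤-trans (s≤s z≤n) (rows (fromℕ K)))
  p : Fin l
  p = proj₁ last-row-one

  notched-bounds : (d : ℕ) → let n = l + d in
                   Σ ℕ λ s → IsSat P n n s × n ≤ 1 * s × s ≤ (K + (l + l)) * n
  notched-bounds d = s , isSat , lower , upper
    where
    open Notched K d p using (M; saturating; weight-M)
    M-saturating : Saturating P M
    M-saturating = saturating P (proj₂ last-row-one)
    s : ℕ
    s = proj₁ (sat-exists P M-saturating)
    isSat : IsSat P (l + d) (l + d) s
    isSat = proj₂ (sat-exists P M-saturating)
    lower : l + d ≤ 1 * s
    lower = subst (l + d ≤_) (sym (*-identityˡ s)) (rows-sat-lower rows isSat (p ↑ˡ d))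
    upper : s ≤ (K + (l + l)) * (l + d)
    upper = ≤-trans (proj₂ isSat M M-saturating) weight-M

  bounds : (n : ℕ) → l ≤ n → Σ ℕ λ s → IsSat P n n s × n ≤ 1 * s × s ≤ (K + (l + l)) * n
  bounds n l≤n with m≤n⇒∃[o]m+o≡n l≤n
  ... | d , refl = notched-bounds d

claim1 : {k l : ℕ} (P : Matrix k l) → IsPattern P →
    (RowsAtLeastTwo P ⊎ ColsAtLeastTwo P) →
    Σ ℕ λ c → Σ ℕ λ C → Σ ℕ λ N → (n : ℕ) → N ≤ n →
      Σ ℕ λ s → IsSat P n n s × n ≤ c * s × s ≤ C * n
claim1 P nonzero (inj₁ rows) = linearSat-rows P nonzero rows
claim1 P (a , b , pab) (inj₂ columns) =
  LinearSat-transpose P (linearSat-rows (transpose P) (b , a , pab) columns)
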